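{- Let $\mathcal L$ be a combined LTSI satisfying Causal Consistency (any two coinitial and cofinal paths are causally equivalent). Then $\mathcal L$ satisfies Unique Transition: if $P\xrightarrow{a}Q$ and $P\xrightarrow{b}Q$ are forward transitions, or $P\xrightarrow{\overline a}Q$ and $P\xrightarrow{\overline b}Q$ are backward transitions, then $a=b$.
   Context: Setting. $\mathrm{Lab}$ is a set of labels and $\overline{\mathrm{Lab}}=\{\overline a: a\in\mathrm{Lab}\}$ a disjoint copy (reverse labels), with $\overline{\overline a}=a$. A combined LTSI $(\mathrm{Proc},\mathrm{Lab},\to,\iota)$ consists of a set $\mathrm{Proc}$ of processes, a set of forward transitions $(P,a,Q)$ with $a\in\mathrm{Lab}$, the set $\to$ of all transitions, consisting of the forward transitions together with, for each forward transition $(P,a,Q)$, the backward transition $(Q,\overline a,P)$, and an irreflexive symmetric relation $\iota$ on transitions. Write $t:P\xrightarrow{\alpha}Q$ for $t=(P,\alpha,Q)$ and $\overline t=(Q,\overline\alpha,P)$. A path is a finite (possibly empty) sequence of consecutive transitions. Paths are coinitial/cofinal if they have the same start/end process. Causal equivalence $\approx$ is the smallest equivalence relation on paths closed under composition and satisfying: (swap) if $t:P\xrightarrow{\alpha}Q$, $u:P\xrightarrow{\beta}R$ with $t\,\iota\,u$ and $u':Q\xrightarrow{\beta}S$, $t':R\xrightarrow{\alpha}S$, then $tu'\approx ut'$; (cancellation) $t\overline t\approx\varepsilon$ and $\overline t t\approx\varepsilon$. -}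

module Defs where

open import Data.Product using (_×_)
open import Relation.Binary.PropositionalEquality using (_≡_)
open import Relation.Nullary using (¬_)

-- Labels of transitions: a forward label a ∈ Lab, or a reverse label ā.
data Label (Lab : Set) : Set where
  fw : Lab → Label Lab
  bw : Lab → Label Lab

bar : {Lab : Set} → Label Lab → Label Lab
bar (fw a) = bw a
bar (bw a) = fw a

-- The underlying LTS: the forward transitions form a *set* of triples
-- (P , a , Q), modelled by the proof-irrelevant predicate Fwd.
record LTS : Set₁ where
  field
    Proc     : Set
    Lab      : Set
    Fwd      : Proc → Lab → Proc → Set
    Fwd-prop : ∀ {P a Q} (x y : Fwd P a Q) → x ≡ y

module LTSNotation (T : LTS) where
  open LTS T public

  -- P —[ α ]→ Q : (P , α , Q) is a transition.  The transitions are the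
  -- forward ones together with, for each forward (P , a , Q), the backward
  -- transition (Q , ā , P).
  _—[_]→_ : Proc → Label Lab → Proc → Set
  P —[ fw a ]→ Q = Fwd P a Q
  P —[ bw a ]→ Q = Fwd Q a P

  record Trans : Set where
    constructor tr
    field
      src : Proc
      lab : Label Lab
      tgt : Proc
      prf : src —[ lab ]→ tgt

  revp : ∀ {P Q} α → P —[ α ]→ Q → Q —[ bar α ]→ P
  revp (fw a) p = p
  revp (bw a) p = p

record LTSI : Set₁ where
  field
    lts : LTS
  open LTSNotation lts
  field
    ι        : Trans → Trans → Set
    ι-irrefl : ∀ t → ¬ ι t t
    ι-sym    : ∀ {t u} → ι t u → ι u t

module Paths (L : LTSI) where
  open LTSI L public
  open LTSNotation lts public

  data Path : Proc → Proc → Set where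
    ε   : ∀ {P} → Path P P
    step : ∀ {P R Q} (α : Label Lab) → P —[ α ]→ R → Path R Q → Path P Q

  _++_ : ∀ {P R Q} → Path P R → Path R Q → Path P Q
  ε ++ q = q
  step α t p ++ q = step α t (p ++ q)

  two : ∀ {P R Q} α β → P —[ α ]→ R → R —[ β ]→ Q → Path P Q
  two α β t u = step α t (step β u ε)

  data _≈_ : ∀ {P Q} → Path P Q → Path P Q → Set where
    ≈-refl  : ∀ {P Q} {p : Path P Q} → p ≈ p
    ≈-sym   : ∀ {P Q} {p q : Path P Q} → p ≈ q → q ≈ p
    ≈-trans : ∀ {P Q} {p q r : Path P Q} → p ≈ q → q ≈ r → p ≈ r
    ≈-comp  : ∀ {P R Q} {p p' : Path P R} {q q' : Path R Q} →
              p ≈ p' → q ≈ q' → (p ++ q) ≈ (p' ++ q')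
    ≈-swap  : ∀ {P Q R S} α β
              (t : P —[ α ]→ Q) (u : P —[ β ]→ R)
              (u' : Q —[ β ]→ S) (t' : R —[ α ]→ S) →
              ι (tr P α Q t) (tr P β R u) →
              two α β t u' ≈ two β α u t'
    ≈-cancel  : ∀ {P Q} α (t : P —[ α ]→ Q) →
                two α (bar α) t (revp α t) ≈ ε
    ≈-cancel' : ∀ {P Q} α (t : P —[ α ]→ Q) →
                two (bar α) α (revp α t) t ≈ ε

CausalConsistency : LTSI → Set
CausalConsistency L = ∀ {P Q} (p q : Path P Q) → p ≈ q
  where open Paths L

UniqueTransition : LTSI → Set
UniqueTransition L =
  (∀ {P Q a b} → P —[ fw a ]→ Q → P —[ fw b ]→ Q → a ≡ b) ×
  (∀ {P Q a b} → P —[ bw a ]→ Q → P —[ bw b ]→ Q → a ≡ b)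
  where open Paths L

-- A causal equivalence may swap two transitions or cancel a transition
-- against its reverse, so it preserves the multiset of forward labels minus
-- the multiset of backward labels of a path. Causal Consistency makes the
-- one-step paths P -a→ Q and P -b→ Q equivalent, hence [a] and [b] are
-- equal multisets and a = b; dually for backward transitions.
module Submission where

open import Defs
open import Algebra.Bundles using (CommutativeSemigroup; CommutativeMonoid)
open import Algebra.Definitions using (LeftCancellative)
open import Data.List using (List; []; _∷_; [_]; _++_)
open import Data.List.Properties using (∷-injectiveˡ)
open import Data.List.Relation.Binary.Permutation.Propositional using (_↭_)
open import Data.List.Relation.Binary.Permutation.Propositional.Properties
  using (drop-mid; ↭-singleton-inv; ++-commutativeMonoid)
open import Data.Product using (_×_; _,_)
open import Relation.Binary.PropositionalEquality using (_≡_; refl; sym; cong; subst₂)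
import Algebra.Properties.CommutativeSemigroup as CommutativeSemigroupProperties
import Relation.Binary.Reasoning.Setoid as SetoidReasoning

-- A pair (x , y) stands for the formal difference x − y, as in the
-- Grothendieck construction.
module FormalDifference {c ℓ} (M : CommutativeSemigroup c ℓ) where
  open CommutativeSemigroup M hiding (refl; sym)
  open CommutativeSemigroup M using () renaming (refl to ≈-refl; sym to ≈-sym)
  open CommutativeSemigroupProperties M using (interchange)
  open SetoidReasoning setoid

  _⊕_ : Carrier × Carrier → Carrier × Carrier → Carrier × Carrier
  (x , y) ⊕ (u , v) = x ∙ u , y ∙ v

  _∼_ : Carrier × Carrier → Carrier × Carrier → Set ℓ
  (x , y) ∼ (x′ , y′) = x ∙ y′ ≈ x′ ∙ y

  ∼-refl : ∀ d → d ∼ d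
  ∼-refl (x , y) = ≈-refl

  ∼-sym : ∀ {d e} → d ∼ e → e ∼ d
  ∼-sym = ≈-sym

  ∼-trans : LeftCancellative _≈_ _∙_ →
            ∀ {d e f} → d ∼ e → e ∼ f → d ∼ f
  ∼-trans cancel {x , y} {x′ , y′} {x″ , y″} d∼e e∼f =
    cancel (x′ ∙ y′) (x ∙ y″) (x″ ∙ y) (begin
      (x′ ∙ y′) ∙ (x ∙ y″)   ≈⟨ interchange x′ y′ x y″ ⟩
      (x′ ∙ x) ∙ (y′ ∙ y″)   ≈⟨ ∙-congʳ (comm x′ x) ⟩
      (x ∙ x′) ∙ (y′ ∙ y″)   ≈⟨ interchange x x′ y′ y″ ⟩
      (x ∙ y′) ∙ (x′ ∙ y″)   ≈⟨ ∙-cong d∼e e∼f ⟩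
      (x′ ∙ y) ∙ (x″ ∙ y′)   ≈⟨ interchange x′ y x″ y′ ⟩
      (x′ ∙ x″) ∙ (y ∙ y′)   ≈⟨ ∙-congˡ (comm y y′) ⟩
      (x′ ∙ x″) ∙ (y′ ∙ y)   ≈⟨ interchange x′ x″ y′ y ⟩
      (x′ ∙ y′) ∙ (x″ ∙ y)   ∎)

  ∼-⊕ : ∀ {d d′ e e′} → d ∼ d′ → e ∼ e′ → (d ⊕ e) ∼ (d′ ⊕ e′)
  ∼-⊕ {x , y} {x′ , y′} {u , v} {u′ , v′} d∼d′ e∼e′ = begin
    (x ∙ u) ∙ (y′ ∙ v′)   ≈⟨ interchange x u y′ v′ ⟩
    (x ∙ y′) ∙ (u ∙ v′)   ≈⟨ ∙-cong d∼d′ e∼e′ ⟩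
    (x′ ∙ y) ∙ (u′ ∙ v)   ≈⟨ interchange x′ y u′ v ⟩
    (x′ ∙ u′) ∙ (y ∙ v)   ∎

  ∼-⊕-comm : ∀ d e → (d ⊕ e) ∼ (e ⊕ d)
  ∼-⊕-comm (x , y) (u , v) = ∙-cong (comm x u) (comm v y)

  ∼-diagonal : ∀ x y → (x , x) ∼ (y , y)
  ∼-diagonal = comm

↭-++-cancelˡ : {A : Set} → LeftCancellative _↭_ (_++_ {A = A})
↭-++-cancelˡ []       ys zs ys↭zs = ys↭zs
↭-++-cancelˡ (x ∷ xs) ys zs x∷xs++ys↭x∷xs++zs =
  ↭-++-cancelˡ xs ys zs (drop-mid [] [] x∷xs++ys↭x∷xs++zs)

module LabelBalance (L : LTSI) where
  open Paths L renaming (_++_ to _++ₚ_)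
  open FormalDifference (CommutativeMonoid.commutativeSemigroup (++-commutativeMonoid {A = Lab}))

  count : Label Lab → List Lab × List Lab
  count (fw a) = [ a ] , []
  count (bw a) = [] , [ a ]

  labels : ∀ {P Q} → Path P Q → List Lab × List Lab
  labels ε            = [] , []
  labels (step α _ p) = count α ⊕ labels p

  labels-++ : ∀ {P R Q} (p : Path P R) (q : Path R Q) →
              labels (p ++ₚ q) ≡ labels p ⊕ labels q
  labels-++ ε                  q = refl
  labels-++ (step (fw a) _ p) q = cong (count (fw a) ⊕_) (labels-++ p q)
  labels-++ (step (bw a) _ p) q = cong (count (bw a) ⊕_) (labels-++ p q)

  ≈⇒labels∼ : ∀ {P Q} {p q : Path P Q} → p ≈ q → labels p ∼ labels q
  ≈⇒labels∼ (≈-refl {p = p})        = ∼-refl (labels p)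
  ≈⇒labels∼ (≈-sym {p = p} {q} p≈q) =
    ∼-sym {labels p} {labels q} (≈⇒labels∼ p≈q)
  ≈⇒labels∼ (≈-trans {p = p} {q} {r} p≈q q≈r) =
    ∼-trans ↭-++-cancelˡ {labels p} {labels q} {labels r} (≈⇒labels∼ p≈q) (≈⇒labels∼ q≈r)
  ≈⇒labels∼ (≈-comp {p = p} {p′} {q} {q′} p≈p′ q≈q′) =
    subst₂ _∼_ (sym (labels-++ p q)) (sym (labels-++ p′ q′))
      (∼-⊕ {labels p} {labels p′} {labels q} {labels q′} (≈⇒labels∼ p≈p′) (≈⇒labels∼ q≈q′))
  -- Splitting the labels lets count α ⊕ (count β ⊕ ([] , [])) reduce to count α ⊕ count β.
  ≈⇒labels∼ (≈-swap (fw a) (fw b) _ _ _ _ _) = ∼-⊕-comm (count (fw a)) (count (fw b))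
  ≈⇒labels∼ (≈-swap (fw a) (bw b) _ _ _ _ _) = ∼-⊕-comm (count (fw a)) (count (bw b))
  ≈⇒labels∼ (≈-swap (bw a) (fw b) _ _ _ _ _) = ∼-⊕-comm (count (bw a)) (count (fw b))
  ≈⇒labels∼ (≈-swap (bw a) (bw b) _ _ _ _ _) = ∼-⊕-comm (count (bw a)) (count (bw b))
  ≈⇒labels∼ (≈-cancel (fw a) _)  = ∼-diagonal [ a ] []
  ≈⇒labels∼ (≈-cancel (bw a) _)  = ∼-diagonal [ a ] []
  ≈⇒labels∼ (≈-cancel' (fw a) _) = ∼-diagonal [ a ] []
  ≈⇒labels∼ (≈-cancel' (bw a) _) = ∼-diagonal [ a ] []

↭-singleton-injective : {A : Set} {a b : A} → [ a ] ↭ [ b ] → a ≡ b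
↭-singleton-injective [a]↭[b] = ∷-injectiveˡ (↭-singleton-inv [a]↭[b])

corollary3p12 : (L : LTSI) → CausalConsistency L → UniqueTransition L
corollary3p12 L causallyConsistent = forward , backward
  where
  open LabelBalance L
  open Paths L using (_—[_]→_; step; ε)

  forward : ∀ {P Q a b} → P —[ fw a ]→ Q → P —[ fw b ]→ Q → a ≡ b
  forward {a = a} {b} t u =
    ↭-singleton-injective (≈⇒labels∼ (causallyConsistent (step (fw a) t ε) (step (fw b) u ε)))

  backward : ∀ {P Q a b} → P —[ bw a ]→ Q → P —[ bw b ]→ Q → a ≡ b
  -- Backward labels sit on the subtracted side, so the two paths are compared in reverse order.
  backward {a = a} {b} t u =
    ↭-singleton-injective (≈⇒labels∼ (causallyConsistent (step (bw b) u ε) (step (bw a) t ε)))
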